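{- Let $c$ and $k$ be positive integers and let $n$ satisfy $c+1\le n\le ck+1$. If $w\in S_n$ is $k$-squished, then $w$ is equivalent to the identity permutation $12\cdots n$.
   Context: Permutations are written in one-line notation. The equivalence on $S_n$ is the equivalence relation generated by declaring $\phi\equiv\psi$ whenever $\phi=aub$, $\psi=avb$ for words $a,b$ and contiguous factors $u,v$ of length $c+1$ whose order permutations (the permutations of $\{1,\ldots,c+1\}$ with the same relative order) both begin with $1$. A permutation in $S_n$ is $k$-squished if for each $j\le k$ (with $j\le n$), the letter $j$ appears among the first $c(j-1)+1$ positions. -}

module Defs where

open import Data.Nat using (ℕ; zero; suc; _+_; _*_; _∸_; _≤_; _<_; _<ᵇ_)
open import Data.Bool using (Bool; true; false; if_then_else_)
open import Data.List using (List; []; _∷_; _++_; length; map; upTo; lookup; filterᵇ; head)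
open import Data.Maybe using (just)
open import Data.List.Relation.Binary.Permutation.Propositional using (_↭_)
open import Data.List.Membership.Propositional using (_∈_)
open import Data.List.Relation.Unary.Any using (Any)
open import Data.Fin using (Fin; toℕ)
open import Data.Product using (Σ; ∃; _×_; _,_)
open import Relation.Binary.PropositionalEquality using (_≡_)
open import Relation.Binary.Construct.Closure.Equivalence using (EqClosure)

-- One-line notation: a permutation of [n] is the list w(1) w(2) ... w(n) of naturals.
-- The identity permutation 1 2 ... n.
idPerm : ℕ → List ℕ
idPerm n = map suc (upTo n)

IsPerm : ℕ → List ℕ → Set
IsPerm n w = w ↭ idPerm n

rank : List ℕ → ℕ → ℕ
rank u x = suc (length (filterᵇ (λ y → y <ᵇ x) u))

orderPerm : List ℕ → List ℕ
orderPerm u = map (rank u) u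

BeginsWith1 : List ℕ → Set
BeginsWith1 u = head (orderPerm u) ≡ just 1

data Move (c n : ℕ) : List ℕ → List ℕ → Set where
  move : (a u v b : List ℕ) →
         IsPerm n (a ++ u ++ b) → IsPerm n (a ++ v ++ b) →
         length u ≡ suc c → length v ≡ suc c →
         BeginsWith1 u → BeginsWith1 v →
         Move c n (a ++ u ++ b) (a ++ v ++ b)

Equiv : ℕ → ℕ → List ℕ → List ℕ → Set
Equiv c n = EqClosure (Move c n)

-- w is k-squished: for each j ≤ k with j ≤ n (j ≥ 1), the letter j appears among
-- the first c(j-1)+1 positions, i.e. at some 0-based index i < c(j-1)+1.
KSquished : ℕ → ℕ → ℕ → List ℕ → Set
KSquished c k n w = ∀ j → 1 ≤ j → j ≤ k → j ≤ n →
  Σ (Fin (length w)) λ i → (lookup w i ≡ j) × (toℕ i < c * (j ∸ 1) + 1)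

-- The first letter of a squished w is 1, so w can be insertion-sorted behind it. Inserting y into
-- the sorted prefix 1 lo hi (lo < y < hi) means moving y leftwards past hi. A move rearranges the c
-- letters following a letter smaller than all of them; the increasing run 1 lo therefore supplies
-- starting letters for windows, and by induction on its length a letter can be carried across
-- (c - 1) |1 lo| letters standing right after the run (if the whole prefix is shorter than c, a single
-- window starting at 1 suffices). Squishedness keeps |hi| within this bound: were 1 lo hi longer than
-- c |1 lo|, the letters 1, …, |1 lo| + 1 would all lie in it and below y, hence in 1 lo.

module Submission where

open import Defs
open import Data.Nat
  using (ℕ; zero; suc; pred; NonZero; >-nonZero; _+_; _*_; _∸_; _≤_; _<_; _>_; _<ᵇ_; z≤n; s≤s; s≤s⁻¹; z<s; _≤?_; _<?_)
open import Data.Nat.Properties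
open import Data.Bool using (T; T?)
open import Data.Empty using (⊥-elim)
open import Data.Fin using (Fin; toℕ) renaming (zero to fzero; suc to fsuc)
open import Data.List using (List; []; _∷_; _++_; _∷ʳ_; [_]; length; upTo; lookup; take; drop; reverse; _ʳ++_)
open import Data.List.Properties
  using (++-assoc; ++-identityʳ; take++drop≡id; length-take; length-drop; length-++; length-map; length-upTo;
         length-reverse; filter-none; ʳ++-defn; reverse-involutive; unfold-reverse)
open import Data.List.Relation.Unary.All as All using (All; []; _∷_)
import Data.List.Relation.Unary.All.Properties as All
open import Data.List.Relation.Unary.Any using (here; there)
import Data.List.Relation.Unary.Any.Properties as Any
open import Data.List.Relation.Unary.AllPairs as AllPairs using (AllPairs; []; _∷_)
import Data.List.Relation.Unary.AllPairs.Properties as AllPairsₚ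
open import Data.List.Relation.Unary.Unique.Propositional using (Unique)
import Data.List.Relation.Unary.Unique.Propositional.Properties as Uniqueₚ
open import Data.List.Membership.Propositional using (_∈_; _∉_)
open import Data.List.Membership.Propositional.Properties using (∈-++⁺ʳ; ∈-++⁻; ∈-map⁻)
open import Data.List.Relation.Binary.Permutation.Propositional
  using (_↭_; ↭⇒↭ₛ; ↭-refl; ↭-sym; ↭-trans; ↭-reflexive; prep; swap)
open import Data.List.Relation.Binary.Permutation.Propositional.Properties
  using (zoom; ↭-reverse; ∷↭∷ʳ; ↭-length; ++⁺ˡ; ++⁺ʳ; All-resp-↭; ∈-resp-↭; drop-∷;
         ↭-empty-inv; ¬x∷xs↭[])
  renaming (shift to ↭-shift)
open import Data.Maybe using (just)
open import Data.Product using (∃; ∃₂; _×_; _,_)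
open import Data.Sum using (inj₁; inj₂)
open import Function using (flip; _∘_)
open import Relation.Binary using (Rel; Setoid)
open import Relation.Binary.PropositionalEquality
  using (_≡_; refl; sym; trans; cong; subst; subst₂; setoid)
open import Data.List.Relation.Binary.Permutation.Setoid.Properties (setoid ℕ) using (Unique-resp-↭)
open import Relation.Binary.Construct.Closure.Equivalence using (return; symmetric)
open import Relation.Binary.Construct.Closure.ReflexiveTransitive using (ε; _◅◅_)
open import Relation.Nullary using (¬_; yes; no; contradiction)

module _ {A : Set} where

  splitAt-prefix : ∀ (xs : List A) {m} → m ≤ length xs →
                   ∃₂ λ (ys zs : List A) → xs ≡ ys ++ zs × length ys ≡ m
  splitAt-prefix xs {m} m≤|xs| =
    take m xs , drop m xs , sym (take++drop≡id m xs) , trans (length-take m xs) (m≤n⇒m⊓n≡m m≤|xs|)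

  splitAt-suffix : ∀ (xs : List A) {m} → m ≤ length xs →
                   ∃₂ λ (ys zs : List A) → xs ≡ ys ++ zs × length zs ≡ m
  splitAt-suffix xs {m} m≤|xs| =
    take k xs , drop k xs , sym (take++drop≡id k xs) , trans (length-drop k xs) (m∸[m∸n]≡n m≤|xs|)
    where k = length xs ∸ m

  Unique⇒∉prefix : ∀ xs {y ys} → Unique {A = A} (xs ++ y ∷ ys) → y ∉ xs
  Unique⇒∉prefix (x ∷ xs) (x∉ ∷ _) (here refl) = All.lookup x∉ (∈-++⁺ʳ xs (here refl)) refl
  Unique⇒∉prefix (x ∷ xs) (_ ∷ u)  (there y∈xs) = Unique⇒∉prefix xs u y∈xs

  lookup-∈-prefix : ∀ (xs ys : List A) (i : Fin (length (xs ++ ys))) → toℕ i < length xs →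
                    lookup (xs ++ ys) i ∈ xs
  lookup-∈-prefix (x ∷ xs) ys fzero    _         = here refl
  lookup-∈-prefix (x ∷ xs) ys (fsuc i) (s≤s i<n) = there (lookup-∈-prefix xs ys i i<n)

AllPairs-reverse⁺ : ∀ {A : Set} {ℓ} {R : Rel A ℓ} {xs} → AllPairs R xs → AllPairs (flip R) (reverse xs)
AllPairs-reverse⁺ [] = []
AllPairs-reverse⁺ {R = R} {x ∷ xs} (x≺xs ∷ xs!) = subst (AllPairs (flip R)) (sym (unfold-reverse x xs))
  (AllPairsₚ.++⁺ (AllPairs-reverse⁺ xs!) ([] ∷ [])
    (All-resp-↭ (↭-sym (↭-reverse xs)) (All.map (_∷ []) x≺xs)))

AllPairs-++⁻ˡ : ∀ {A : Set} {ℓ} {R : Rel A ℓ} xs {ys} → AllPairs R (xs ++ ys) → AllPairs R xs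
AllPairs-++⁻ˡ []       _          = []
AllPairs-++⁻ˡ (x ∷ xs) (x≺ ∷ xs!) = All.++⁻ˡ xs x≺ ∷ AllPairs-++⁻ˡ xs xs!

↗↭↗⇒≡ : ∀ {xs ys} → AllPairs _<_ xs → AllPairs _<_ ys → xs ↭ ys → xs ≡ ys
↗↭↗⇒≡ {[]}              _ _ p = sym (↭-empty-inv (↭-sym p))
↗↭↗⇒≡ {x ∷ xs} {[]}     _ _ p = contradiction p ¬x∷xs↭[]
↗↭↗⇒≡ {x ∷ xs} {y ∷ ys} (x< ∷ xs↗) (y< ∷ ys↗) p
  with ∈-resp-↭ p (here refl) | ∈-resp-↭ (↭-sym p) (here refl)
... | here refl  | _          = cong (x ∷_) (↗↭↗⇒≡ xs↗ ys↗ (drop-∷ p))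
... | there x∈ys | here refl  = contradiction (All.lookup y< x∈ys) (<-irrefl refl)
... | there x∈ys | there y∈xs = ⊥-elim (<-asym (All.lookup y< x∈ys) (All.lookup x< y∈xs))

↗-insert : ∀ lo {y} hi → AllPairs _<_ (lo ++ hi) → All (_< y) lo → All (y <_) hi → AllPairs _<_ (lo ++ y ∷ hi)
↗-insert []       hi hi↗ []          y<hi = y<hi ∷ hi↗
↗-insert (x ∷ lo) hi (x< ∷ ↗) (x<y ∷ lo<y) y<hi with All.++⁻ lo x<
... | x<lo , x<hi = All.++⁺ x<lo (x<y ∷ x<hi) ∷ ↗-insert lo hi ↗ lo<y y<hi

↗-split : ∀ {xs} y → AllPairs _<_ xs → y ∉ xs →
          ∃₂ λ (lo hi : List ℕ) → xs ≡ lo ++ hi × All (_< y) lo × All (y <_) hi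
↗-split {[]}     y _ _ = [] , [] , refl , [] , []
↗-split {x ∷ xs} y (x< ∷ xs↗) y∉ with x <? y
... | yes x<y with ↗-split y xs↗ (y∉ ∘ there)
...   | lo , hi , refl , lo<y , y<hi = x ∷ lo , hi , refl , x<y ∷ lo<y , y<hi
↗-split {x ∷ xs} y (x< ∷ xs↗) y∉ | no x≮y = [] , x ∷ xs , refl , [] , y<x ∷ All.map (<-trans y<x) x<
  where y<x = ≤∧≢⇒< (≮⇒≥ x≮y) (y∉ ∘ here)

↘-covering⇒≤length : ∀ {xs} g → AllPairs _>_ xs → (∀ i → i < g → suc i ∈ xs) → g ≤ length xs
↘-covering⇒≤length zero _ _ = z≤n
↘-covering⇒≤length {[]} (suc g) _ covers with covers g ≤-refl
... | ()
↘-covering⇒≤length {x ∷ xs} (suc g) (x> ∷ xs↘) covers = s≤s (↘-covering⇒≤length g xs↘ covers′)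
  where
    g<x : g < x
    g<x with covers g ≤-refl
    ... | here refl = ≤-refl
    ... | there g∈ = <⇒≤ (All.lookup x> g∈)
    covers′ : ∀ i → i < g → suc i ∈ xs
    covers′ i i<g with covers i (m<n⇒m<1+n i<g)
    ... | here refl = contradiction (≤-pred g<x) (<⇒≱ i<g)
    ... | there i∈  = i∈

idPerm-↗ : ∀ n → AllPairs _<_ (idPerm n)
idPerm-↗ n = AllPairsₚ.map⁺ (AllPairsₚ.applyUpTo⁺₁ (λ i → i) n (λ i<j _ → s≤s i<j))

squished⇒1∷ : ∀ {c k n w} → 1 ≤ k → 1 ≤ n → KSquished c k n w → ∃ λ ws → w ≡ 1 ∷ ws
squished⇒1∷ {c} {w = w} 1≤k 1≤n sq with w | sq 1 ≤-refl 1≤k 1≤n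
... | []     | () , _
... | x ∷ ws | fzero  , x≡1 , _  = ws , cong (_∷ ws) x≡1
... | x ∷ ws | fsuc i , _   , i< = contradiction (subst (λ m → suc (toℕ i) < m + 1) (*-zeroʳ c) i<) λ { (s≤s ()) }

-- The side conditions i + 1 ≤ k and i + 1 ≤ n of KSquished follow from c i < |xs| < n ≤ c k + 1.
squished⇒∈prefix : ∀ {c k n} xs ys → 1 ≤ c → n ≤ c * k + 1 → length xs < n →
                   KSquished c k n (xs ++ ys) → ∀ i → c * i < length xs → suc i ∈ xs
squished⇒∈prefix {c} {k} {n} xs ys 1≤c n≤ck+1 |xs|<n sq i ci<|xs|
  with sq (suc i) (s≤s z≤n) (*-cancelˡ-< c i k ci<ck) (≤-trans (s≤s i≤ci) (≤-trans ci<|xs| (<⇒≤ |xs|<n)))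
  where
    ci<ck : c * i < c * k
    ci<ck = ≤-pred (≤-trans (s≤s ci<|xs|) (≤-trans |xs|<n (≤-trans n≤ck+1 (≤-reflexive (+-comm (c * k) 1)))))
    i≤ci : i ≤ c * i
    i≤ci = m≤n*m i c {{>-nonZero 1≤c}}
... | ix , ix≡ , ix< = subst (_∈ xs) ix≡
  (lookup-∈-prefix xs ys ix (≤-trans ix< (≤-trans (≤-reflexive (+-comm (c * i) 1)) ci<|xs|)))

min-head⇒BeginsWith1 : ∀ {q xs} → All (q <_) xs → BeginsWith1 (q ∷ xs)
min-head⇒BeginsWith1 {q} q<xs =
  cong (just ∘ suc ∘ length) (filter-none (T? ∘ (_<ᵇ q)) (≮ᵇ ≤-refl ∷ All.map (≮ᵇ ∘ <⇒≤) q<xs))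
  where
    ≮ᵇ : ∀ {x} → q ≤ x → ¬ T (x <ᵇ q)
    ≮ᵇ q≤x x<q = <⇒≱ (<ᵇ⇒< _ q x<q) q≤x

module Factors (c n : ℕ) where

  infix 4 _∼_
  record _∼_ (u v : List ℕ) : Set where
    field
      perm      : u ↭ v
      inContext : ∀ a b → IsPerm n (a ++ u ++ b) → Equiv c n (a ++ u ++ b) (a ++ v ++ b)
  open _∼_ public

  private
    reframe : ∀ {u v} → u ∼ v → (f : List ℕ → List ℕ) (a b : List ℕ) → (∀ x → f x ≡ a ++ x ++ b) →
              IsPerm n (f u) → Equiv c n (f u) (f v)
    reframe u∼v f a b f≡ π =
      subst₂ (Equiv c n) (sym (f≡ _)) (sym (f≡ _)) (inContext u∼v a b (subst (IsPerm n) (f≡ _) π))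

  ∼-refl : ∀ {u} → u ∼ u
  ∼-refl = record { perm = ↭-refl ; inContext = λ _ _ _ → ε }

  ∼-sym : ∀ {u v} → u ∼ v → v ∼ u
  ∼-sym u∼v = record
    { perm      = ↭-sym (perm u∼v)
    ; inContext = λ a b π → symmetric _ (inContext u∼v a b (↭-trans (zoom a (perm u∼v)) π))
    }

  ∼-trans : ∀ {u v w} → u ∼ v → v ∼ w → u ∼ w
  ∼-trans u∼v v∼w = record
    { perm      = ↭-trans (perm u∼v) (perm v∼w)
    ; inContext = λ a b π →
        inContext u∼v a b π ◅◅ inContext v∼w a b (↭-trans (zoom a (↭-sym (perm u∼v))) π)
    }

  ∼-setoid : Setoid _ _
  ∼-setoid = record
    { Carrier       = List ℕ
    ; _≈_           = _∼_
    ; isEquivalence = record { refl = ∼-refl ; sym = ∼-sym ; trans = ∼-trans }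
    }

  ∼-++⁺ˡ : ∀ l {u v} → u ∼ v → l ++ u ∼ l ++ v
  ∼-++⁺ˡ l u∼v = record
    { perm      = ++⁺ˡ l (perm u∼v)
    ; inContext = λ a b → reframe u∼v (λ x → a ++ (l ++ x) ++ b) (a ++ l) b
        (λ x → trans (cong (a ++_) (++-assoc l x b)) (sym (++-assoc a l (x ++ b))))
    }

  ∼-++⁺ʳ : ∀ r {u v} → u ∼ v → u ++ r ∼ v ++ r
  ∼-++⁺ʳ r u∼v = record
    { perm      = ++⁺ʳ r (perm u∼v)
    ; inContext = λ a b → reframe u∼v (λ x → a ++ (x ++ r) ++ b) a (r ++ b)
        (λ x → cong (a ++_) (++-assoc x r b))
    }

  ∼-ʳ++⁺ : ∀ K {u v} → u ∼ v → K ʳ++ u ∼ K ʳ++ v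
  ∼-ʳ++⁺ []      u∼v = u∼v
  ∼-ʳ++⁺ (x ∷ K) u∼v = ∼-ʳ++⁺ K (∼-++⁺ˡ [ x ] u∼v)

  ∼⇒Equiv : ∀ {u v} → u ∼ v → IsPerm n u → Equiv c n u v
  ∼⇒Equiv u∼v = reframe u∼v (λ x → x) [] [] (λ x → sym (++-identityʳ x))

  window-exact : ∀ {q u v} → All (q <_) u → u ↭ v → length u ≡ c → q ∷ u ∼ q ∷ v
  window-exact q<u u↭v |u|≡c = record
    { perm      = prep _ u↭v
    ; inContext = λ a b π → return (move a _ _ b π (↭-trans (zoom a (prep _ (↭-sym u↭v))) π)
        (cong suc |u|≡c) (cong suc (trans (sym (↭-length u↭v)) |u|≡c))
        (min-head⇒BeginsWith1 q<u) (min-head⇒BeginsWith1 (All-resp-↭ u↭v q<u)))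
    }

  open import Relation.Binary.Reasoning.Setoid ∼-setoid public

  window : ∀ {q} u {u'} T → All (q <_) (u ++ T) → u ↭ u' → length u ≤ c → c ≤ length (u ++ T) →
           q ∷ u ++ T ∼ q ∷ u' ++ T
  window {q} u {u'} T q<uT u↭u' |u|≤c c≤|uT|
    with splitAt-prefix T (m≤n+o⇒m∸n≤o c (length u) (subst (c ≤_) (length-++ u) c≤|uT|))
  ... | T₁ , T₂ , refl , |T₁| = begin
      q ∷ u ++ T₁ ++ T₂     ≡⟨ cong (q ∷_) (++-assoc u T₁ T₂) ⟨
      (q ∷ u ++ T₁) ++ T₂   ≈⟨ ∼-++⁺ʳ T₂ (window-exact q<uT₁ (++⁺ʳ T₁ u↭u') |uT₁|) ⟩
      (q ∷ u' ++ T₁) ++ T₂  ≡⟨ cong (q ∷_) (++-assoc u' T₁ T₂) ⟩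
      q ∷ u' ++ T₁ ++ T₂    ∎
    where
      q<uT₁ : All (q <_) (u ++ T₁)
      q<uT₁ = All.++⁻ˡ (u ++ T₁) (subst (All (q <_)) (sym (++-assoc u T₁ T₂)) q<uT)
      |uT₁| : length (u ++ T₁) ≡ c
      |uT₁| = trans (length-++ u) (trans (cong (length u +_) |T₁|) (m+[n∸m]≡n |u|≤c))

module Runs (c' n : ℕ) where

  c : ℕ
  c = suc c'

  open Factors c n public

  -- The stack q ∷ K is an increasing run read from right to left, so (q ∷ K) ʳ++ Z is the
  -- run followed by Z; a window of length c + 1 starting at its first letter fits.
  record RunBefore (q : ℕ) (K Z : List ℕ) : Set where
    field
      descending : AllPairs _>_ (q ∷ K)
      below      : All (q <_) Z
      room       : c ≤ length K + length Z
  open RunBefore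

  RunBefore-resp-↭ : ∀ {q K Z Z'} → Z ↭ Z' → RunBefore q K Z → RunBefore q K Z'
  RunBefore-resp-↭ {K = K} Z↭Z' r = record
    { descending = descending r
    ; below      = All-resp-↭ Z↭Z' (below r)
    ; room       = subst (λ m → c ≤ length K + m) (↭-length Z↭Z') (room r)
    }

  RunBefore-pop : ∀ {q q' K Z} → RunBefore q (q' ∷ K) Z → RunBefore q' K (q ∷ Z)
  RunBefore-pop {K = K} {Z} r with descending r
  ... | (q'<q ∷ _) ∷ q'∷K↘ = record
    { descending = q'∷K↘
    ; below      = q'<q ∷ All.map (<-trans q'<q) (below r)
    ; room       = subst (c ≤_) (sym (+-suc (length K) (length Z))) (room r)
    }

  run-permute : ∀ {q K} u {u'} T → RunBefore q K (u ++ T) → u ↭ u' → length u ≤ c →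
                (q ∷ K) ʳ++ (u ++ T) ∼ (q ∷ K) ʳ++ (u' ++ T)
  run-permute {K = K} u T r u↭u' |u|≤c with c ≤? length (u ++ T)
  ... | yes c≤|uT| = ∼-ʳ++⁺ K (window u T (below r) u↭u' |u|≤c c≤|uT|)
  run-permute {K = []}    u T r _    _     | no c≰|uT| = contradiction (room r) c≰|uT|
  run-permute {K = _ ∷ _} u T r u↭u' |u|≤c | no c≰|uT| =
    run-permute (_ ∷ u) T (RunBefore-pop r) (prep _ u↭u') (≤-trans (s≤s |u|≤|uT|) (≰⇒> c≰|uT|))
    where
      |u|≤|uT| : length u ≤ length (u ++ T)
      |u|≤|uT| = subst (length u ≤_) (sym (length-++ u)) (m≤m+n _ _)

  run-swap-near : ∀ {q K} X y d T → RunBefore q K (X ++ y ∷ d ∷ T) → length X < c' →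
                  (q ∷ K) ʳ++ (X ++ y ∷ d ∷ T) ∼ (q ∷ K) ʳ++ (X ++ d ∷ y ∷ T)
  run-swap-near {q} {K} X y d T r |X|<c' = begin
      R ʳ++ (X ++ y ∷ d ∷ T)          ≡⟨ cong (R ʳ++_) (++-assoc X _ T) ⟨
      R ʳ++ ((X ++ y ∷ d ∷ []) ++ T)  ≈⟨ run-permute (X ++ y ∷ d ∷ []) T r′ (++⁺ˡ X (swap y d ↭-refl)) |Xyd|≤c ⟩
      R ʳ++ ((X ++ d ∷ y ∷ []) ++ T)  ≡⟨ cong (R ʳ++_) (++-assoc X _ T) ⟩
      R ʳ++ (X ++ d ∷ y ∷ T)          ∎
    where
      R = q ∷ K
      r′ = subst (RunBefore q K) (sym (++-assoc X _ T)) r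
      |Xyd|≤c : length (X ++ y ∷ d ∷ []) ≤ c
      |Xyd|≤c = subst (_≤ c) (sym (trans (length-++ X) (+-comm (length X) 2))) (s≤s |X|<c')

  -- A transposition too far from the run for one window is brought near: carry q up to it
  -- using the shorter run q' ∷ K, swap within a window starting at q, and carry q back.
  run-shift : ∀ {q K} X y W T → RunBefore q K (X ++ y ∷ W ++ T) →
              length X + length W ≤ c' * length (q ∷ K) →
              (q ∷ K) ʳ++ (X ++ y ∷ W ++ T) ∼ (q ∷ K) ʳ++ (X ++ W ++ y ∷ T)
  run-swap  : ∀ {q K} X y d T → RunBefore q K (X ++ y ∷ d ∷ T) → length X < c' * length (q ∷ K) →
              (q ∷ K) ʳ++ (X ++ y ∷ d ∷ T) ∼ (q ∷ K) ʳ++ (X ++ d ∷ y ∷ T)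

  run-shift X y []      T r cap = ∼-refl
  run-shift {q} {K} X y (d ∷ W) T r cap = begin
      R ʳ++ (X ++ y ∷ d ∷ W ++ T)     ≈⟨ run-swap X y d (W ++ T) r (<-≤-trans (m<m+n (length X) z<s) cap) ⟩
      R ʳ++ (X ++ d ∷ y ∷ W ++ T)     ≡⟨ cong (R ʳ++_) (++-assoc X [ d ] _) ⟨
      R ʳ++ ((X ∷ʳ d) ++ y ∷ W ++ T)  ≈⟨ run-shift (X ∷ʳ d) y W T r′ cap′ ⟩
      R ʳ++ ((X ∷ʳ d) ++ W ++ y ∷ T)  ≡⟨ cong (R ʳ++_) (++-assoc X [ d ] _) ⟩
      R ʳ++ (X ++ d ∷ W ++ y ∷ T)     ∎
    where
      R = q ∷ K
      r′ : RunBefore q K ((X ∷ʳ d) ++ y ∷ W ++ T)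
      r′ = RunBefore-resp-↭ (↭-trans (++⁺ˡ X (swap y d ↭-refl)) (↭-reflexive (sym (++-assoc X [ d ] _)))) r
      cap′ : length (X ∷ʳ d) + length W ≤ c' * length R
      cap′ = subst (_≤ c' * length R)
        (sym (trans (cong (_+ length W) (length-++ X)) (+-assoc (length X) 1 (length W)))) cap

  run-swap X y d T r cap with length X <? c'
  ... | yes |X|<c' = run-swap-near X y d T r |X|<c'
  run-swap {K = []} X y d T r cap | no |X|≮c' = contradiction (subst (length X <_) (*-identityʳ c') cap) |X|≮c'
  run-swap {q} {q' ∷ K} X y d T r cap | no |X|≮c'
    with splitAt-suffix X {pred c'} (≤-trans pred[n]≤n (≮⇒≥ |X|≮c'))
  ... | A₁ , A₂ , refl , |A₂| = begin
      S ʳ++ (q ∷ (A₁ ++ A₂) ++ y ∷ d ∷ T)  ≡⟨ cong (λ Z → S ʳ++ (q ∷ Z)) (++-assoc A₁ A₂ _) ⟩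
      S ʳ++ (q ∷ A₁ ++ A₂ ++ y ∷ d ∷ T)    ≈⟨ run-shift [] q A₁ (A₂ ++ y ∷ d ∷ T) (RunBefore-pop r₁) cap₁ ⟩
      S ʳ++ (A₁ ++ q ∷ A₂ ++ y ∷ d ∷ T)    ≈⟨ ∼-ʳ++⁺ S (∼-++⁺ˡ A₁ (run-swap-near A₂ y d T r₂ |A₂|<c')) ⟩
      S ʳ++ (A₁ ++ q ∷ A₂ ++ d ∷ y ∷ T)    ≈⟨ run-shift [] q A₁ (A₂ ++ d ∷ y ∷ T) (RunBefore-pop r₃) cap₁ ⟨
      S ʳ++ (q ∷ A₁ ++ A₂ ++ d ∷ y ∷ T)    ≡⟨ cong (λ Z → S ʳ++ (q ∷ Z)) (++-assoc A₁ A₂ _) ⟨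
      S ʳ++ (q ∷ (A₁ ++ A₂) ++ d ∷ y ∷ T)  ∎
    where
      S = q' ∷ K
      instance
        c'≢0 : NonZero c'
        c'≢0 = m*n≢0⇒m≢0 c' {{>-nonZero (<-≤-trans z<s cap)}}
      1+|A₂|≡c' : suc (length A₂) ≡ c'
      1+|A₂|≡c' = trans (cong suc |A₂|) (suc-pred c')
      |A₂|<c' : length A₂ < c'
      |A₂|<c' = ≤-reflexive 1+|A₂|≡c'
      r₁ : RunBefore q S (A₁ ++ A₂ ++ y ∷ d ∷ T)
      r₁ = subst (RunBefore q S) (++-assoc A₁ A₂ _) r
      r₃ : RunBefore q S (A₁ ++ A₂ ++ d ∷ y ∷ T)
      r₃ = RunBefore-resp-↭ (++⁺ˡ A₁ (++⁺ˡ A₂ (swap y d ↭-refl))) r₁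
      r₂ : RunBefore q [] (A₂ ++ y ∷ d ∷ T)
      r₂ = record
        { descending = [] ∷ []
        ; below      = All.++⁻ʳ A₁ (below r₁)
        ; room       = subst₂ _≤_ (cong suc 1+|A₂|≡c')
            (sym (trans (length-++ A₂) (trans (+-suc _ _) (cong suc (+-suc _ _)))))
            (s≤s (s≤s (m≤m+n (length A₂) (length T))))
        }
      cap₁ : length A₁ ≤ c' * length S
      cap₁ = +-cancelˡ-≤ c' _ _ (subst₂ _≤_
        (trans (cong suc (length-++ A₁))
          (trans (sym (+-suc _ _)) (trans (cong (length A₁ +_) 1+|A₂|≡c') (+-comm _ c'))))
        (*-suc c' (length S)) cap)

  run-rotate : ∀ R y W → AllPairs _>_ R → All (_< y) R → All (y <_) W →
               length W ≤ c' * length R → c ≤ length R + length W →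
               R ʳ++ (y ∷ W) ∼ R ʳ++ (W ++ [ y ])
  run-rotate []      y W _ _ _ cap c≤|W| =
    contradiction (≤-trans c≤|W| (subst (length W ≤_) (*-zeroʳ c') cap)) λ ()
  run-rotate (q ∷ K) y W R↘ (q<y ∷ _) y<W cap c≤|RW| = begin
      (q ∷ K) ʳ++ (y ∷ W)             ≡⟨ cong (λ Z → (q ∷ K) ʳ++ (y ∷ Z)) (++-identityʳ W) ⟨
      (q ∷ K) ʳ++ (y ∷ W ++ [])       ≈⟨ run-shift [] y W [] r cap ⟩
      (q ∷ K) ʳ++ (W ++ [ y ])        ∎
    where
      r : RunBefore q K (y ∷ W ++ [])
      r = record
        { descending = R↘
        ; below      = q<y ∷ All.++⁺ (All.map (<-trans q<y) y<W) []
        ; room       = subst (λ m → c ≤ length K + suc m) (cong length (sym (++-identityʳ W)))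
                         (subst (c ≤_) (sym (+-suc (length K) (length W))) c≤|RW|)
        }

  insert-after-run : ∀ x lo W y T → AllPairs _<_ (x ∷ lo) → All (_< y) (x ∷ lo) → All (y <_) W →
                     All (x <_) T → c ≤ length (lo ++ W ++ y ∷ T) → length W ≤ c' * length (x ∷ lo) →
                     x ∷ lo ++ W ++ y ∷ T ∼ x ∷ lo ++ y ∷ W ++ T
  insert-after-run x lo W y T L↗ L<y y<W x<T room cap with c ≤? length (x ∷ lo) + length W
  ... | yes c≤|LW| = begin
      L ++ W ++ y ∷ T                     ≡⟨ reassoc (W ++ [ y ]) (++-assoc W [ y ] T) ⟨
      (reverse L ʳ++ (W ++ [ y ])) ++ T   ≈⟨ ∼-++⁺ʳ T (run-rotate (reverse L) y W (AllPairs-reverse⁺ L↗)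
                                               (All-resp-↭ (↭-sym (↭-reverse L)) L<y) y<W
                                               (subst (λ m → length W ≤ c' * m) (sym (length-reverse L)) cap)
                                               (subst (λ m → c ≤ m + length W) (sym (length-reverse L)) c≤|LW|)) ⟨
      (reverse L ʳ++ (y ∷ W)) ++ T        ≡⟨ reassoc (y ∷ W) refl ⟩
      L ++ y ∷ W ++ T                     ∎
    where
      L = x ∷ lo
      reassoc : ∀ Z {Z'} → Z ++ T ≡ Z' → (reverse L ʳ++ Z) ++ T ≡ L ++ Z'
      reassoc Z eq = trans (cong (_++ T) (trans (ʳ++-defn (reverse L)) (cong (_++ Z) (reverse-involutive L))))
                           (trans (++-assoc L Z T) (cong (L ++_) eq))
  ... | no c≰|LW| = begin
      x ∷ lo ++ W ++ y ∷ T             ≡⟨ cong (x ∷_) assoc ⟨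
      x ∷ (lo ++ W ++ [ y ]) ++ T      ≈⟨ window (lo ++ W ++ [ y ]) T (subst (All (x <_)) (sym assoc) x<)
                                            (++⁺ˡ lo (↭-sym (∷↭∷ʳ y W))) |u|≤c (subst (c ≤_) (cong length (sym assoc)) room) ⟩
      x ∷ (lo ++ y ∷ W) ++ T           ≡⟨ cong (x ∷_) (++-assoc lo (y ∷ W) T) ⟩
      x ∷ lo ++ y ∷ W ++ T             ∎
    where
      assoc : (lo ++ W ++ [ y ]) ++ T ≡ lo ++ W ++ y ∷ T
      assoc = trans (++-assoc lo (W ++ [ y ]) T) (cong (lo ++_) (++-assoc W [ y ] T))
      x< : All (x <_) (lo ++ W ++ y ∷ T)
      x< = All.++⁺ (AllPairs.head L↗) (All.++⁺ (All.map (<-trans (All.head L<y)) y<W) (All.head L<y ∷ x<T))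
      |u|≤c : length (lo ++ W ++ [ y ]) ≤ c
      |u|≤c = subst (_≤ c)
        (sym (trans (length-++ lo) (trans (cong (length lo +_) (trans (length-++ W) (+-comm (length W) 1))) (+-suc _ _))))
                (<⇒≤ (≰⇒> c≰|LW|))

module InsertionSort (c' k n : ℕ) (ws : List ℕ) (w∈Sₙ : IsPerm n (1 ∷ ws))
                     (sq : KSquished (suc c') k n (1 ∷ ws))
                     (n≤ck+1 : n ≤ suc c' * k + 1) (c+1≤n : suc c' + 1 ≤ n) where
  open Runs c' n

  unique : Unique (1 ∷ ws)
  unique = Unique-resp-↭ (↭⇒↭ₛ (↭-sym w∈Sₙ)) (Uniqueₚ.map⁺ suc-injective (Uniqueₚ.upTo⁺ n))

  1<ws : All (1 <_) ws
  1<ws with unique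
  ... | 1∉ws ∷ _ =
    All.zipWith (λ (x∈ , 1≢x) → ≤∧≢⇒< (positive x∈) 1≢x) (All.tabulate (λ x∈ → x∈) , 1∉ws)
    where
      positive : ∀ {x} → x ∈ ws → 1 ≤ x
      positive x∈ws with ∈-map⁻ suc (∈-resp-↭ w∈Sₙ (there x∈ws))
      ... | _ , _ , refl = s≤s z≤n

  length-1∷ws : suc (length ws) ≡ n
  length-1∷ws = trans (↭-length w∈Sₙ) (trans (length-map suc (upTo n)) (length-upTo n))

  -- If c |L| < |A|, squishedness puts 1, …, |L| + 1 into A, all below y (or y would be in A
  -- too), hence all into L, which is too short to hold them.
  run-capacity : ∀ A y B L → 1 ∷ ws ≡ A ++ y ∷ B → 1 ≤ y → AllPairs _<_ L →
                 (∀ {x} → x ∈ A → x < y → x ∈ L) → length A ≤ c * length L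
  run-capacity A (suc y') B L w≡ (s≤s z≤n) L↗ A<y⊆L with length A ≤? c * length L
  ... | yes |A|≤cL = |A|≤cL
  ... | no  |A|≰cL = contradiction
      (subst (suc (length L) ≤_) (length-reverse L)
        (↘-covering⇒≤length (suc (length L)) (AllPairs-reverse⁺ L↗) covers))
      (n≮n (length L))
    where
      ∈A : ∀ i → i ≤ length L → suc i ∈ A
      ∈A i i≤L = squished⇒∈prefix {c} {k} {n} A (suc y' ∷ B) (s≤s z≤n) n≤ck+1 |A|<n
                   (subst (KSquished c k n) w≡ sq) i
                   (≤-<-trans (*-monoʳ-≤ c i≤L) (≰⇒> |A|≰cL))
        where
          |A|<n : length A < n
          |A|<n = subst (length A <_) (trans (cong length (sym w≡)) length-1∷ws)
                    (subst (length A <_) (sym (length-++ A)) (m<m+n (length A) z<s))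
      y∉A : suc y' ∉ A
      y∉A = Unique⇒∉prefix A (subst Unique w≡ unique)
      covers : ∀ i → i < suc (length L) → suc i ∈ reverse L
      covers i i≤L with suc i <? suc y'
      ... | yes i<y = Any.reverse⁺ (A<y⊆L (∈A i (s≤s⁻¹ i≤L)) i<y)
      ... | no  i≮y = contradiction (∈A y' (≤-trans (s≤s⁻¹ (≮⇒≥ i≮y)) (s≤s⁻¹ i≤L))) y∉A

  lo-capacity : ∀ pre y rest lo hi → ws ≡ pre ++ y ∷ rest → lo ++ hi ↭ pre → AllPairs _<_ (1 ∷ lo) →
                All (y <_) hi → 1 ≤ y → length hi ≤ c' * length (1 ∷ lo)
  lo-capacity pre y rest lo hi ws≡ lohi↭pre 1∷lo↗ y<hi 1≤y =
    +-cancelˡ-≤ (length (1 ∷ lo)) _ _ (subst (_≤ c * length (1 ∷ lo))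
      (cong suc (trans (sym (↭-length lohi↭pre)) (length-++ lo)))
      (run-capacity (1 ∷ pre) y rest (1 ∷ lo) (cong (1 ∷_) ws≡) 1≤y 1∷lo↗ below-y⊆1∷lo))
    where
      below-y⊆1∷lo : ∀ {x} → x ∈ 1 ∷ pre → x < y → x ∈ 1 ∷ lo
      below-y⊆1∷lo (here x≡1)    _   = here x≡1
      below-y⊆1∷lo (there x∈pre) x<y with ∈-++⁻ lo (∈-resp-↭ (↭-sym lohi↭pre) x∈pre)
      ... | inj₁ x∈lo = there x∈lo
      ... | inj₂ x∈hi = contradiction (All.lookup y<hi x∈hi) (<-asym x<y)

  record SortedUpTo (pre rest : List ℕ) : Set where
    field
      sorted    : List ℕ
      ascending : AllPairs _<_ (1 ∷ sorted)
      sorted↭   : sorted ↭ pre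
      equiv     : Equiv c n (1 ∷ ws) (1 ∷ sorted ++ rest)

  insert : ∀ pre y rest → ws ≡ pre ++ y ∷ rest → SortedUpTo pre (y ∷ rest) → SortedUpTo (pre ∷ʳ y) rest
  insert pre y rest ws≡ record { sorted = S ; ascending = 1∷S↗ ; sorted↭ = S↭pre ; equiv = E }
    with ↗-split y (AllPairs.tail 1∷S↗) (y∉pre ∘ ∈-resp-↭ S↭pre)
    where
      y∉pre : y ∉ pre
      y∉pre = Unique⇒∉prefix (1 ∷ pre) (subst Unique (cong (1 ∷_) ws≡) unique) ∘ there
  ... | lo , hi , refl , lo<y , y<hi = record
    { sorted    = lo ++ y ∷ hi
    ; ascending = ↗-insert (1 ∷ lo) hi 1∷S↗ (1<y ∷ lo<y) y<hi
    ; sorted↭   = ↭-trans (↭-shift y lo hi) (↭-trans (prep y S↭pre) (∷↭∷ʳ y pre))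
    ; equiv     = E ◅◅ subst₂ (Equiv c n) (cong (1 ∷_) (sym (++-assoc lo hi _)))
                                          (cong (1 ∷_) (sym (++-assoc lo (y ∷ hi) rest)))
                                          (∼⇒Equiv key π)
    }
    where
      1<pre·y·rest : All (1 <_) (pre ++ y ∷ rest)
      1<pre·y·rest = subst (All (1 <_)) ws≡ 1<ws
      1<y : 1 < y
      1<y = All.head (All.++⁻ʳ pre 1<pre·y·rest)
      lohi·y·rest↭ws : lo ++ hi ++ y ∷ rest ↭ ws
      lohi·y·rest↭ws =
        ↭-trans (↭-reflexive (sym (++-assoc lo hi _))) (↭-trans (++⁺ʳ _ S↭pre) (↭-reflexive (sym ws≡)))
      π : IsPerm n (1 ∷ lo ++ hi ++ y ∷ rest)
      π = ↭-trans (prep 1 lohi·y·rest↭ws) w∈Sₙ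
      c≤|ws| : c ≤ length (lo ++ hi ++ y ∷ rest)
      c≤|ws| = subst (c ≤_) (sym (↭-length lohi·y·rest↭ws))
                 (s≤s⁻¹ (subst₂ _≤_ (+-comm c 1) (sym length-1∷ws) c+1≤n))
      1∷lo↗ : AllPairs _<_ (1 ∷ lo)
      1∷lo↗ = AllPairs-++⁻ˡ (1 ∷ lo) 1∷S↗
      key : 1 ∷ lo ++ hi ++ y ∷ rest ∼ 1 ∷ lo ++ y ∷ hi ++ rest
      key = insert-after-run 1 lo hi y rest 1∷lo↗ (1<y ∷ lo<y) y<hi
              (All.tail (All.++⁻ʳ pre 1<pre·y·rest)) c≤|ws|
              (lo-capacity pre y rest lo hi ws≡ S↭pre 1∷lo↗ y<hi (<⇒≤ 1<y))

  sort-from : ∀ pre rest → ws ≡ pre ++ rest → SortedUpTo pre rest → SortedUpTo ws []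
  sort-from pre []         ws≡ s = subst (λ p → SortedUpTo p []) (sym (trans ws≡ (++-identityʳ pre))) s
  sort-from pre (y ∷ rest) ws≡ s =
    sort-from (pre ∷ʳ y) rest (trans ws≡ (sym (++-assoc pre [ y ] rest))) (insert pre y rest ws≡ s)

  1∷ws≡idPerm : Equiv c n (1 ∷ ws) (idPerm n)
  1∷ws≡idPerm
    with sort-from [] ws refl (record { sorted = [] ; ascending = [] ∷ [] ; sorted↭ = ↭-refl ; equiv = ε })
  ... | record { sorted = S ; ascending = 1∷S↗ ; sorted↭ = S↭ws ; equiv = E } =
    subst (Equiv c n (1 ∷ ws)) (↗↭↗⇒≡ 1∷S↗ (idPerm-↗ n) (↭-trans (prep 1 S↭ws) w∈Sₙ))
      (subst (λ S′ → Equiv c n (1 ∷ ws) (1 ∷ S′)) (++-identityʳ S) E)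

mainTheorem11 : (c k n : ℕ) → 1 ≤ c → 1 ≤ k → c + 1 ≤ n → n ≤ c * k + 1 →
                (w : List ℕ) → IsPerm n w → KSquished c k n w →
                Equiv c n w (idPerm n)
mainTheorem11 (suc c') k n _ 1≤k c+1≤n n≤ck+1 w w∈Sₙ sq
  with squished⇒1∷ {suc c'} {k} {n} {w} 1≤k (≤-trans (s≤s z≤n) c+1≤n) sq
... | ws , refl = InsertionSort.1∷ws≡idPerm c' k n ws w∈Sₙ sq n≤ck+1 c+1≤n
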